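{- Let $A$ be a finite set of items, $\mathcal{F}$ an antimonotonic family of itemsets over $A$, and $B\subseteq A$. Run the Algorithm (described in the context) on input $B$ and $\mathcal{F}$. Let $C$ be the current set at the start of some iteration of the outer loop in which a violation is found, and let $Z$ be the set of items added to $C$ in that iteration. Then for every safe set $Y$ with $C\subseteq Y$ we have $Z\subseteq Y$.
   Context: An itemset is a subset of $A=\{a_1,\dots,a_K\}$; $S_U(z)=1$ iff $z_i=1$ for all $a_i\in U$. $\mathcal{F}$ is antimonotonic if closed under subsets. A distribution $p$ on $\{0,1\}^K$ satisfies $\theta=(\theta_U)_{U\in\mathcal{F}}$ if $E_p[S_U]=\theta_U$ for all $U\in\mathcal{F}$; "frequencies for $\mathcal{F}$" are such $\theta$ satisfied by some distribution. For $C\subseteq A$, $\pi_C\theta=(\theta_U)_{U\in\mathcal{F},U\subseteq C}$ and $\pi_Cp$ is the marginal of $p$ on the coordinates in $C$. $C$ is safe if for all frequencies $\theta$ for $\mathcal{F}$, every distribution $q$ on $\{0,1\}^C$ with $E_q[S_U]=\theta_U$ for all $U\in\mathcal{F}$, $U\subseteq C$, has an extension $p$ on $\{0,1\}^K$ (i.e. $\pi_Cp=q$) satisfying $\theta$. The dependency graph $G$ has vertex set $A$ and edges $\{a_i,a_j\}$ ($i\ne j$) with $\{a_i,a_j\}\in\mathcal{F}$. For $x\notin C$ and $r\ge 0$, the restricted neighbourhood $N(x,r;C)$ is the set of items $y$ reachable from $x$ by a path in $G$ of length (number of edges) at most $r$ in which only the last vertex may belong to $C$. The rank of $x$ w.r.t.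 $C$ is the vector $\mathrm{rank}(x,C)\in\mathbb{Z}^{|A|-1}$ with $i$-th entry $|C\cap(N(x,i;C)\setminus N(x,i-1;C))|$; ranks are compared lexicographically. The Algorithm: set $C:=B$. Repeat the following outer loop: set $r:=1$ and $V:=\{x\notin C: x \text{ is adjacent in } G \text{ to some } y\in C\}$; then repeat: for each $x\in V$ set $U_x:=N(x,r;C)\cap C$; if some $U_x\notin\mathcal{F}$, stop this inner loop (a violation is found); otherwise $r:=r+1$; the inner loop also stops when no $U_x$ changed. If a violation was found, let $W:=\{x\in V:U_x\notin\mathcal{F}\}$, $v:=\max\{\mathrm{rank}(x,C):x\in W\}$, $Z:=\{x\in W:\mathrm{rank}(x,C)=v\}$, and set $C:=C\cup Z$. The outer loop terminates when no violation is found, and the final $C$ is output. -}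

module Defs where

open import Level using (0ℓ)
open import Data.Nat as ℕ using (ℕ; zero; suc; _∸_)
open import Data.Fin using (Fin; toℕ)
open import Data.Bool using (Bool; true; false; _∧_; _∨_; not; if_then_else_)
open import Data.Vec using (Vec; []; _∷_; tabulate; lookup)
open import Data.Vec.Properties using (≡-dec)
open import Data.List using (List; []; _∷_; _++_; map; foldr; filter)
open import Data.Fin.Subset
  using (Subset; _∈_; _∉_; _⊆_; _∩_; _∪_; _─_; ⁅_⁆; ∣_∣; inside; outside)
open import Data.Fin.Subset.Properties using (_⊆?_)
open import Data.Vec.Relation.Binary.Lex.NonStrict using (Lex-≤)
open import Data.Rational using (ℚ; 0ℚ; 1ℚ; _+_; _≤_)
open import Data.Product using (Σ; ∃; _×_; _,_)
open import Data.Sum using (_⊎_)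
open import Data.Unit using (⊤; tt)
open import Relation.Nullary using (¬_; Dec; yes; no)
open import Relation.Nullary.Decidable using (does; _×-dec_)
open import Relation.Unary using (Pred; Decidable)
open import Relation.Binary.PropositionalEquality using (_≡_; _≢_)
import Data.Bool.Properties as BoolP
import Data.Fin.Properties as FinP

-- Items are Fin K; itemsets (and points z ∈ {0,1}^K, identified with
-- the set of coordinates equal to 1) are Subset K = Vec Bool K.

allSubsets : (K : ℕ) → List (Subset K)
allSubsets zero = [] ∷ []
allSubsets (suc K) =
  map (inside ∷_) (allSubsets K) ++ map (outside ∷_) (allSubsets K)

sumOver : {K : ℕ} {P : Pred (Subset K) 0ℓ} → Decidable P →
          (Subset K → ℚ) → ℚ
sumOver {K} P? f = foldr (λ z acc → f z + acc) 0ℚ (filter P? (allSubsets K))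

Family : ℕ → Set₁
Family K = Pred (Subset K) 0ℓ

Antimonotonic : {K : ℕ} → Family K → Set
Antimonotonic {K} F = ∀ (U V : Subset K) → U ⊆ V → F V → F U

IsDist : {K : ℕ} → (Subset K → ℚ) → Set
IsDist {K} p = (∀ z → 0ℚ ≤ p z) × sumOver {P = λ _ → ⊤} (λ _ → yes tt) p ≡ 1ℚ

-- Expectation of S_U under p: Σ_{z ⊇ U} p(z).
E[S] : {K : ℕ} → (Subset K → ℚ) → Subset K → ℚ
E[S] p U = sumOver (U ⊆?_) p

Satisfies : {K : ℕ} → Family K → (Subset K → ℚ) → (Subset K → ℚ) → Set
Satisfies {K} F θ p = ∀ (U : Subset K) → F U → E[S] p U ≡ θ U

IsFrequency : {K : ℕ} → Family K → (Subset K → ℚ) → Set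
IsFrequency {K} F θ = Σ (Subset K → ℚ) λ p → IsDist p × Satisfies F θ p

-- A distribution on {0,1}^C, with {0,1}^C identified with the subsets
-- w ⊆ C of Fin K (the values of q at w ⊈ C are irrelevant).
IsDistOn : {K : ℕ} → Subset K → (Subset K → ℚ) → Set
IsDistOn {K} C q = (∀ w → w ⊆ C → 0ℚ ≤ q w) × sumOver (_⊆? C) q ≡ 1ℚ

E[S]On : {K : ℕ} → Subset K → (Subset K → ℚ) → Subset K → ℚ
E[S]On C q U = sumOver (λ w → (U ⊆? w) ×-dec (w ⊆? C)) q

-- The marginal of p on C agrees with q: for every w ⊆ C,
-- Σ_{z : z ∩ C = w} p(z) = q(w).
Extends : {K : ℕ} → Subset K → (Subset K → ℚ) → (Subset K → ℚ) → Set
Extends {K} C p q =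
  ∀ (w : Subset K) → w ⊆ C →
    sumOver (λ z → ≡-dec BoolP._≟_ (z ∩ C) w) p ≡ q w

Safe : {K : ℕ} → Family K → Subset K → Set
Safe {K} F C =
  ∀ (θ : Subset K → ℚ) → IsFrequency F θ →
  ∀ (q : Subset K → ℚ) → IsDistOn C q →
    (∀ (U : Subset K) → F U → U ⊆ C → E[S]On C q U ≡ θ U) →
    Σ (Subset K → ℚ) λ p → IsDist p × Extends C p q × Satisfies F θ p

module Algorithm (K : ℕ) (F : Family K) (F? : Decidable F) where

  adj : Fin K → Fin K → Bool
  adj x y = not (does (x FinP.≟ y)) ∧ does (F? (⁅ x ⁆ ∪ ⁅ y ⁆))

  Adj : Fin K → Fin K → Set
  Adj x y = x ≢ y × F (⁅ x ⁆ ∪ ⁅ y ⁆)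

  anyFin : (Fin K → Bool) → Bool
  anyFin f = foldr (λ i b → f i ∨ b) false (Data.List.allFin K)
    where import Data.List

  -- restricted neighbourhood N(x, r; C): items reachable from x by a walk
  -- of length ≤ r in G in which only the last vertex may lie in C
  -- (computed breadth-first: step r+1 extends from the non-C vertices of
  -- N(x, r; C)).
  N : Subset K → Fin K → ℕ → Subset K
  N C x zero = ⁅ x ⁆
  N C x (suc r) = tabulate λ y →
    lookup (N C x r) y ∨
    anyFin (λ z → lookup (N C x r) z ∧ not (lookup C z) ∧ adj z y)

  Ux : Subset K → Fin K → ℕ → Subset K
  Ux C x r = N C x r ∩ C

  InV : Subset K → Fin K → Set
  InV C x = x ∉ C × ∃ λ y → y ∈ C × Adj x y

  -- The inner loop (started at r = 1) stops with a violation at step r: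
  -- at every earlier step r' (1 ≤ r' < r) all U_x were in F and some U_x
  -- changed (compared with step r' − 1), and at step r some U_x ∉ F.
  ViolationAt : Subset K → ℕ → Set
  ViolationAt C r =
    1 ℕ.≤ r ×
    (∀ r' → 1 ℕ.≤ r' → r' ℕ.< r →
        (∀ x → InV C x → F (Ux C x r')) ×
        (∃ λ x → InV C x × Ux C x r' ≢ Ux C x (r' ∸ 1))) ×
    (∃ λ x → InV C x × ¬ F (Ux C x r))

  InW : Subset K → ℕ → Fin K → Set
  InW C r x = InV C x × ¬ F (Ux C x r)

  -- rank(x, C) ∈ ℕ^{K-1}: i-th entry (i = 1..K-1) is
  -- |C ∩ (N(x,i;C) \ N(x,i-1;C))|
  rank : Subset K → Fin K → Vec ℕ (K ∸ 1)
  rank C x = tabulate λ i →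
    ∣ C ∩ (N C x (suc (toℕ i)) ─ N C x (toℕ i)) ∣

  _≤lex_ : Vec ℕ (K ∸ 1) → Vec ℕ (K ∸ 1) → Set
  _≤lex_ = Lex-≤ _≡_ ℕ._≤_

  InZ : Subset K → ℕ → Fin K → Set
  InZ C r x = InW C r x × (∀ y → InW C r y → rank C y ≤lex rank C x)

  -- One outer iteration with a violation turns C into C' = C ∪ Z.
  -- Run B C: C is the current set at the start of some outer iteration
  -- of the algorithm started with input B.
  data Run (B : Subset K) : Subset K → Set where
    start : Run B B
    step  : ∀ {C C' : Subset K} (r : ℕ) → Run B C → ViolationAt C r →
            (∀ x → (x ∈ C' → x ∈ C ⊎ InZ C r x) ×
                   (x ∈ C ⊎ InZ C r x → x ∈ C')) →
            Run B C'

-- Let x ∈ Z lie outside a safe set Y ⊇ C and put T = N(x, L; Y) ∩ Y with L = r + K.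
--
-- If T ∈ F, then T is a clique of G.  Take c ∈ U_x ∖ T and follow a shortest walk from x to c
-- through items outside C up to its first item t of Y.  Then t ∈ T ∖ C, and as T is a clique,
-- t reaches every item of C that x reaches, within the same number of steps, and it reaches c
-- strictly earlier than x does.  Hence t ∈ W and rank(t, C) is lexicographically larger than
-- rank(x, C), contradicting x ∈ Z.
--
-- If T ∉ F, then Y is not safe.  Put S = N(x, L; Y) ∖ Y, let p₀ be uniform on the subsets of T
-- of even size except that the mass of ∅ is moved to S, and let q be uniform on the subsets of
-- T of odd size.  Every U ∈ F with U ⊆ Y misses some d ∈ T, and toggling d exchanges the two
-- parity classes, so q has the frequencies θ of p₀ on such U.  But θ{u} = θ{u,v} for every edge
-- uv inside S and θ{u,v} = 0 for every edge from S to T, so under any distribution satisfying θ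
-- every point of positive probability that contains x avoids T.  Its restriction to Y is then
-- not charged by q, although θ{x} > 0; hence no extension of q satisfies θ.
module Submission where

open import Defs
open import Level using (0ℓ)
open import Function using (_∘_; _⇔_; mk⇔)
open import Function.Construct.Identity using (⇔-id)
open import Function.Construct.Symmetry using (⇔-sym)
open import Data.Empty using (⊥; ⊥-elim)
open import Data.Unit using (tt)
open import Data.Product using (∃; _×_; _,_; proj₁; proj₂; uncurry)
open import Data.Sum using (_⊎_; inj₁; inj₂)
open import Data.Bool using (Bool; true; false; not; _∧_; _∨_; _xor_; if_then_else_)
import Data.Bool.Properties as Boolₚ
open import Data.Nat as ℕ using (ℕ; zero; suc)
import Data.Nat.Properties as ℕₚ
open import Data.Fin as Fin using (Fin)
open import Data.Fin.Properties using (¬∀⟶∃¬; nonZeroIndex)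
open import Data.List using (List; []; _∷_; _++_; map; foldr; filter; allFin)
import Data.List.Membership.Propositional as List
open import Data.List.Membership.Propositional.Properties
  using (∈-++⁺ˡ; ∈-++⁺ʳ; ∈-map⁺; ∈-filter⁺; ∈-filter⁻; ∈-allFin)
open import Data.List.Relation.Unary.Any using (here; there)
open import Data.Vec using ([]; _∷_; lookup; tabulate; _[_]%=_; here; there)
open import Data.Vec.Properties
  using ( ≡-dec; []=⇒lookup; lookup⇒[]=; lookup∘tabulate
        ; updateAt-updateAt; updateAt-id-local; updateAt-minimal )
open import Data.Vec.Relation.Binary.Lex.NonStrict using (Lex-≤)
open import Data.Vec.Relation.Binary.Lex.Core using (this; next)
open import Data.Fin.Subset
  using (Subset; _∈_; _∉_; _⊆_; inside; outside; ⁅_⁆; ∁; _∪_; _∩_; _─_; Empty; ∣_∣) renaming (⊥ to ∅)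
open import Data.Fin.Subset.Properties
  using ( _∈?_; _⊆?_; ∉⊥; x∈⁅x⁆; x∈⁅y⁆⇒x≡y; x∈∁p⇒x∉p; x∉p⇒x∈∁p
        ; x∈p∩q⁺; x∈p∩q⁻; x∈p∪q⁻
        ; p⊆p∪q; q⊆p∪q; p∩q⊆p; p∩q⊆q; drop-∷-⊆; Empty-unique
        ; ∣⊥∣≡0; ∣⁅x⁆∣≡1; ∣p∣≤n; p⊆q⇒∣p∣≤∣q∣; p⊂q⇒∣p∣<∣q∣ )
open import Data.Rational using (ℚ; 0ℚ; 1ℚ; _+_; _*_; _≤_; _<_; 1/_; NonZero; Positive; positive)
open import Data.Rational.Properties
open import Algebra.Bundles using (CommutativeMonoid)
open import Algebra.Properties.Group +-0-group using (identityʳ-unique)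
open import Algebra.Properties.CommutativeSemigroup
  (CommutativeMonoid.commutativeSemigroup +-0-commutativeMonoid) using (interchange)
open import Relation.Nullary using (¬_; Dec; yes; no; does; _×-dec_; _→-dec_; ¬?)
open import Relation.Nullary.Decidable using (dec-true; dec-false; does-⇔)
open import Relation.Unary using (Pred; Decidable)
open import Relation.Binary.Definitions using (DecidableEquality)
open import Relation.Binary.PropositionalEquality

infix 5 _when_
_when_ : ℚ → Bool → ℚ
q when b = if b then q else 0ℚ

∑ : {A : Set} → List A → (A → ℚ) → ℚ
∑ L f = foldr (λ z acc → f z + acc) 0ℚ L

module _ {A : Set} where

  ∑-cong : (L : List A) {f g : A → ℚ} → (∀ z → f z ≡ g z) → ∑ L f ≡ ∑ L g
  ∑-cong []      f≗g = refl
  ∑-cong (z ∷ L) f≗g = cong₂ _+_ (f≗g z) (∑-cong L f≗g)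

  ∑-null : (L : List A) {f : A → ℚ} → (∀ {z} → z List.∈ L → f z ≡ 0ℚ) → ∑ L f ≡ 0ℚ
  ∑-null []      f≡0 = refl
  ∑-null (z ∷ L) f≡0 = trans (cong₂ _+_ (f≡0 (here refl)) (∑-null L (f≡0 ∘ there))) (+-identityˡ 0ℚ)

  ∑-+ : (L : List A) (f g : A → ℚ) → ∑ L (λ z → f z + g z) ≡ ∑ L f + ∑ L g
  ∑-+ []      f g = sym (+-identityˡ 0ℚ)
  ∑-+ (z ∷ L) f g = trans (cong (f z + g z +_) (∑-+ L f g)) (interchange (f z) (g z) (∑ L f) (∑ L g))

  ∑-*ˡ : (L : List A) (k : ℚ) (f : A → ℚ) → ∑ L (λ z → k * f z) ≡ k * ∑ L f
  ∑-*ˡ []      k f = sym (*-zeroʳ k)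
  ∑-*ˡ (z ∷ L) k f = trans (cong (k * f z +_) (∑-*ˡ L k f)) (sym (*-distribˡ-+ k (f z) (∑ L f)))

  ∑-++ : (L M : List A) (f : A → ℚ) → ∑ (L ++ M) f ≡ ∑ L f + ∑ M f
  ∑-++ []      M f = sym (+-identityˡ (∑ M f))
  ∑-++ (z ∷ L) M f = trans (cong (f z +_) (∑-++ L M f)) (sym (+-assoc (f z) (∑ L f) (∑ M f)))

  ∑-map : {B : Set} (g : B → A) (L : List B) (f : A → ℚ) → ∑ (map g L) f ≡ ∑ L (f ∘ g)
  ∑-map g []      f = refl
  ∑-map g (z ∷ L) f = cong (f (g z) +_) (∑-map g L f)

  ∑-filter : {P : Pred A 0ℓ} (P? : Decidable P) (L : List A) (f : A → ℚ) →
             ∑ (filter P? L) f ≡ ∑ L (λ z → f z when does (P? z))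
  ∑-filter P? []      f = refl
  ∑-filter P? (z ∷ L) f with does (P? z)
  ... | true  = cong (f z +_) (∑-filter P? L f)
  ... | false = trans (∑-filter P? L f) (sym (+-identityˡ _))

  ∑-nonneg : (L : List A) {f : A → ℚ} → (∀ z → 0ℚ ≤ f z) → 0ℚ ≤ ∑ L f
  ∑-nonneg []      f≥0 = ≤-refl
  ∑-nonneg (z ∷ L) f≥0 = ≤-trans (≤-reflexive (sym (+-identityˡ 0ℚ))) (+-mono-≤ (f≥0 z) (∑-nonneg L f≥0))

  ∑-≥-term : (L : List A) {f : A → ℚ} → (∀ z → 0ℚ ≤ f z) → ∀ {z} → z List.∈ L → f z ≤ ∑ L f
  ∑-≥-term (w ∷ L) {f} f≥0 (here refl) =
    ≤-trans (≤-reflexive (sym (+-identityʳ (f w)))) (+-monoʳ-≤ (f w) (∑-nonneg L f≥0))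
  ∑-≥-term (w ∷ L) {f} f≥0 {z} (there z∈L) =
    ≤-trans (≤-reflexive (sym (+-identityˡ (f z)))) (+-mono-≤ (f≥0 w) (∑-≥-term L f≥0 z∈L))

  ∑>0⇒∃>0 : (L : List A) {f : A → ℚ} → 0ℚ < ∑ L f → ∃ λ z → z List.∈ L × 0ℚ < f z
  ∑>0⇒∃>0 []      0<0 = ⊥-elim (<-irrefl refl 0<0)
  ∑>0⇒∃>0 (z ∷ L) {f} 0<∑ with 0ℚ <? f z | 0ℚ <? ∑ L f
  ... | yes 0<fz | _        = z , here refl , 0<fz
  ... | no  0≮fz | no  0≮∑L =
    ⊥-elim (<-irrefl refl (<-≤-trans 0<∑
      (≤-trans (+-mono-≤ (≮⇒≥ 0≮fz) (≮⇒≥ 0≮∑L)) (≤-reflexive (+-identityˡ 0ℚ)))))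
  ... | no  _    | yes 0<∑L with ∑>0⇒∃>0 L 0<∑L
  ...   | w , w∈L , 0<fw = w , there w∈L , 0<fw

∑-swap : {A B : Set} (L : List A) (M : List B) (f : A → B → ℚ) →
         ∑ L (λ a → ∑ M (f a)) ≡ ∑ M (λ b → ∑ L (λ a → f a b))
∑-swap []      M f = sym (∑-null M (λ _ → refl))
∑-swap (a ∷ L) M f = trans (cong (∑ M (f a) +_) (∑-swap L M f)) (sym (∑-+ M (f a) _))

infix 4 _≟ₛ_
_≟ₛ_ : {K : ℕ} → DecidableEquality (Subset K)
_≟ₛ_ = ≡-dec Boolₚ._≟_

∑ₛ : {K : ℕ} → (Subset K → ℚ) → ℚ
∑ₛ {K} = ∑ (allSubsets K)

∈-allSubsets : {K : ℕ} (z : Subset K) → z List.∈ allSubsets K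
∈-allSubsets []                  = here refl
∈-allSubsets (true  ∷ z)         = ∈-++⁺ˡ (∈-map⁺ _ (∈-allSubsets z))
∈-allSubsets {suc K} (false ∷ z) =
  ∈-++⁺ʳ (map (inside ∷_) (allSubsets K)) (∈-map⁺ _ (∈-allSubsets z))

∑ₛ-suc : {K : ℕ} (f : Subset (suc K) → ℚ) → ∑ₛ f ≡ ∑ₛ (f ∘ (inside ∷_)) + ∑ₛ (f ∘ (outside ∷_))
∑ₛ-suc {K} f = trans (∑-++ (map (inside ∷_) (allSubsets K)) _ f)
                     (cong₂ _+_ (∑-map (inside ∷_) (allSubsets K) f) (∑-map (outside ∷_) (allSubsets K) f))

∑ₛ-point : {K : ℕ} (v : Subset K) (g : Subset K → ℚ) → ∑ₛ (λ w → g w when does (w ≟ₛ v)) ≡ g v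
∑ₛ-point []                  g = +-identityʳ (g [])
∑ₛ-point {suc K} (true ∷ v)  g = begin
  ∑ₛ (λ w → g w when does (w ≟ₛ true ∷ v))
    ≡⟨ ∑ₛ-suc (λ w → g w when does (w ≟ₛ true ∷ v)) ⟩
  ∑ₛ (λ w → g (true ∷ w) when does (w ≟ₛ v)) + ∑ₛ {K} (λ _ → 0ℚ)
    ≡⟨ cong₂ _+_ (∑ₛ-point v (g ∘ (true ∷_))) (∑-null (allSubsets K) (λ _ → refl)) ⟩
  g (true ∷ v) + 0ℚ
    ≡⟨ +-identityʳ _ ⟩
  g (true ∷ v) ∎
  where open ≡-Reasoning
∑ₛ-point {suc K} (false ∷ v) g = begin
  ∑ₛ (λ w → g w when does (w ≟ₛ false ∷ v))
    ≡⟨ ∑ₛ-suc (λ w → g w when does (w ≟ₛ false ∷ v)) ⟩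
  ∑ₛ {K} (λ _ → 0ℚ) + ∑ₛ (λ w → g (false ∷ w) when does (w ≟ₛ v))
    ≡⟨ cong₂ _+_ (∑-null (allSubsets K) (λ _ → refl)) (∑ₛ-point v (g ∘ (false ∷_))) ⟩
  0ℚ + g (false ∷ v)
    ≡⟨ +-identityˡ _ ⟩
  g (false ∷ v) ∎
  where open ≡-Reasoning

∑ₛ-∘-involution : {K : ℕ} (σ : Subset K → Subset K) → (∀ z → σ (σ z) ≡ z) →
                  (f : Subset K → ℚ) → ∑ₛ (f ∘ σ) ≡ ∑ₛ f
∑ₛ-∘-involution {K} σ σσ≗id f = begin
  ∑ₛ (λ z → f (σ z))
    ≡⟨ ∑-cong all (λ z → sym (∑ₛ-point (σ z) f)) ⟩
  ∑ₛ (λ z → ∑ₛ (λ w → f w when does (w ≟ₛ σ z)))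
    ≡⟨ ∑-swap all all (λ z w → f w when does (w ≟ₛ σ z)) ⟩
  ∑ₛ (λ w → ∑ₛ (λ z → f w when does (w ≟ₛ σ z)))
    ≡⟨ ∑-cong all (λ w → ∑-cong all (λ z → cong (f w when_) (flip-sides w z))) ⟩
  ∑ₛ (λ w → ∑ₛ (λ z → f w when does (z ≟ₛ σ w)))
    ≡⟨ ∑-cong all (λ w → ∑ₛ-point (σ w) (λ _ → f w)) ⟩
  ∑ₛ f ∎
  where
  open ≡-Reasoning
  all : List (Subset K)
  all = allSubsets K
  flip-sides : ∀ w z → does (w ≟ₛ σ z) ≡ does (z ≟ₛ σ w)
  flip-sides w z =
    does-⇔ (mk⇔ (λ { refl → sym (σσ≗id z) }) (λ { refl → sym (σσ≗id w) })) (w ≟ₛ σ z) (z ≟ₛ σ w)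

module _ {K : ℕ} {P : Pred (Subset K) 0ℓ} (P? : Decidable P) {f : Subset K → ℚ} where

  sumOver-∑ₛ : sumOver P? f ≡ ∑ₛ (λ z → f z when does (P? z))
  sumOver-∑ₛ = ∑-filter P? (allSubsets K) f

  sumOver-≥-term : (∀ z → 0ℚ ≤ f z) → ∀ {z} → P z → f z ≤ sumOver P? f
  sumOver-≥-term f≥0 {z} Pz = ∑-≥-term (filter P? (allSubsets K)) f≥0 (∈-filter⁺ P? (∈-allSubsets z) Pz)

  sumOver>0⇒∃>0 : 0ℚ < sumOver P? f → ∃ λ z → P z × 0ℚ < f z
  sumOver>0⇒∃>0 0<∑ with ∑>0⇒∃>0 (filter P? (allSubsets K)) 0<∑
  ... | z , z∈ , 0<fz = z , proj₂ (∈-filter⁻ P? {xs = allSubsets K} z∈) , 0<fz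

  sumOver-null : (∀ z → P z → f z ≡ 0ℚ) → sumOver P? f ≡ 0ℚ
  sumOver-null f≡0 = ∑-null (filter P? (allSubsets K)) (f≡0 _ ∘ proj₂ ∘ ∈-filter⁻ P? {xs = allSubsets K})

module _ {K : ℕ} {Q : Pred (Subset K) 0ℓ} (Q? : Decidable Q) {f : Subset K → ℚ}
         (f-off-Q : ∀ z → ¬ Q z → f z ≡ 0ℚ) where

  sumOver-support : sumOver Q? f ≡ ∑ₛ f
  sumOver-support = trans (sumOver-∑ₛ Q?) (∑-cong (allSubsets K) drop-Q)
    where
    drop-Q : ∀ z → (f z when does (Q? z)) ≡ f z
    drop-Q z with Q? z
    ... | yes _  = refl
    ... | no ¬Qz = sym (f-off-Q z ¬Qz)

  sumOver-×-support : {P : Pred (Subset K) 0ℓ} (P? : Decidable P) →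
                      sumOver (λ z → P? z ×-dec Q? z) f ≡ sumOver P? f
  sumOver-×-support P? = begin
    sumOver (λ z → P? z ×-dec Q? z) f                ≡⟨ sumOver-∑ₛ (λ z → P? z ×-dec Q? z) ⟩
    ∑ₛ (λ z → f z when does (P? z) ∧ does (Q? z))    ≡⟨ ∑-cong (allSubsets K) drop-Q ⟩
    ∑ₛ (λ z → f z when does (P? z))                  ≡⟨ sumOver-∑ₛ P? ⟨
    sumOver P? f                                      ∎
    where
    open ≡-Reasoning
    drop-Q : ∀ z → (f z when does (P? z) ∧ does (Q? z)) ≡ (f z when does (P? z))
    drop-Q z with P? z | Q? z
    ... | no  _ | _      = refl
    ... | yes _ | yes _  = refl
    ... | yes _ | no ¬Qz = sym (f-off-Q z ¬Qz)

E[S]-cong : {K : ℕ} {p q : Subset K → ℚ} → (∀ z → p z ≡ q z) → ∀ {U} → E[S] p U ≡ E[S] q U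
E[S]-cong {K} p≗q {U} = ∑-cong (filter (U ⊆?_) (allSubsets K)) p≗q

⊇but⊉? : {K : ℕ} (U V : Subset K) → Decidable (λ z → U ⊆ z × ¬ V ⊆ z)
⊇but⊉? U V z = U ⊆? z ×-dec ¬? (V ⊆? z)

module _ {K : ℕ} {p : Subset K → ℚ} where

  E[S]-split : {U V : Subset K} → U ⊆ V → E[S] p U ≡ E[S] p V + sumOver (⊇but⊉? U V) p
  E[S]-split {U} {V} U⊆V = begin
    E[S] p U
      ≡⟨ sumOver-∑ₛ (U ⊆?_) ⟩
    ∑ₛ (λ z → p z when does (U ⊆? z))
      ≡⟨ ∑-cong (allSubsets K) split ⟩
    ∑ₛ (λ z → (p z when does (V ⊆? z)) + (p z when does (⊇but⊉? U V z)))
      ≡⟨ ∑-+ (allSubsets K) (λ z → p z when does (V ⊆? z)) (λ z → p z when does (⊇but⊉? U V z)) ⟩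
    ∑ₛ (λ z → p z when does (V ⊆? z)) + ∑ₛ (λ z → p z when does (⊇but⊉? U V z))
      ≡⟨ cong₂ _+_ (sumOver-∑ₛ (V ⊆?_)) (sumOver-∑ₛ (⊇but⊉? U V)) ⟨
    E[S] p V + sumOver (⊇but⊉? U V) p ∎
    where
    open ≡-Reasoning
    split : ∀ z → (p z when does (U ⊆? z)) ≡ (p z when does (V ⊆? z)) + (p z when does (⊇but⊉? U V z))
    split z with U ⊆? z | V ⊆? z
    ... | yes _   | yes _   = sym (+-identityʳ (p z))
    ... | yes _   | no  _   = sym (+-identityˡ (p z))
    ... | no  U⊈z | yes V⊆z = ⊥-elim (U⊈z (V⊆z ∘ U⊆V))
    ... | no  _   | no  _   = sym (+-identityˡ 0ℚ)

  E[S]-≡ : {U V : Subset K} → U ⊆ V → (∀ z → U ⊆ z → ¬ V ⊆ z → p z ≡ 0ℚ) → E[S] p U ≡ E[S] p V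
  E[S]-≡ {U} {V} U⊆V p≡0 = begin
    E[S] p U                           ≡⟨ E[S]-split U⊆V ⟩
    E[S] p V + sumOver (⊇but⊉? U V) p  ≡⟨ cong (E[S] p V +_) (sumOver-null (⊇but⊉? U V) (uncurry ∘ p≡0)) ⟩
    E[S] p V + 0ℚ                      ≡⟨ +-identityʳ (E[S] p V) ⟩
    E[S] p V                           ∎
    where open ≡-Reasoning

  E[S]-∘-involution : (σ : Subset K → Subset K) → (∀ z → σ (σ z) ≡ z) →
                      {U : Subset K} → (∀ z → U ⊆ σ z ⇔ U ⊆ z) → E[S] (p ∘ σ) U ≡ E[S] p U
  E[S]-∘-involution σ σσ≗id {U} U⊆σ⇔U⊆ = begin
    E[S] (p ∘ σ) U                          ≡⟨ sumOver-∑ₛ (U ⊆?_) ⟩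
    ∑ₛ (λ z → p (σ z) when does (U ⊆? z))   ≡⟨ ∑-cong (allSubsets K) move-σ ⟩
    ∑ₛ (λ z → p (σ z) when does (U ⊆? σ z)) ≡⟨ ∑ₛ-∘-involution σ σσ≗id (λ w → p w when does (U ⊆? w)) ⟩
    ∑ₛ (λ z → p z when does (U ⊆? z))       ≡⟨ sumOver-∑ₛ (U ⊆?_) ⟨
    E[S] p U                                ∎
    where
    open ≡-Reasoning
    move-σ : ∀ z → (p (σ z) when does (U ⊆? z)) ≡ (p (σ z) when does (U ⊆? σ z))
    move-σ z = cong (p (σ z) when_) (sym (does-⇔ (U⊆σ⇔U⊆ z) (U ⊆? σ z) (U ⊆? z)))

  module _ (p≥0 : ∀ z → 0ℚ ≤ p z) where

    E[S]-≡⇒⊆ : {U V z : Subset K} → U ⊆ V → E[S] p U ≡ E[S] p V → U ⊆ z → 0ℚ < p z → V ⊆ z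
    E[S]-≡⇒⊆ {U} {V} {z} U⊆V EU≡EV U⊆z 0<pz with V ⊆? z
    ... | yes V⊆z = V⊆z
    ... | no  V⊈z = ⊥-elim (<-irrefl refl (<-≤-trans 0<pz (≤-trans pz≤rest (≤-reflexive rest≡0))))
      where
      pz≤rest : p z ≤ sumOver (⊇but⊉? U V) p
      pz≤rest = sumOver-≥-term (⊇but⊉? U V) p≥0 (U⊆z , V⊈z)
      rest≡0 : sumOver (⊇but⊉? U V) p ≡ 0ℚ
      rest≡0 = identityʳ-unique (E[S] p V) _ (trans (sym (E[S]-split U⊆V)) EU≡EV)

    E[S]≡0⇒¬>0 : {U z : Subset K} → E[S] p U ≡ 0ℚ → U ⊆ z → ¬ 0ℚ < p z
    E[S]≡0⇒¬>0 {U} EU≡0 U⊆z 0<pz =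
      <-irrefl refl (<-≤-trans 0<pz (≤-trans (sumOver-≥-term (U ⊆?_) p≥0 U⊆z) (≤-reflexive EU≡0)))

module Uniform {K : ℕ} (member : Subset K → Bool) (z₀ : Subset K) (z₀∈ : member z₀ ≡ true) where

  size : ℚ
  size = ∑ₛ (λ w → 1ℚ when member w)

  size>0 : 0ℚ < size
  size>0 = <-≤-trans (positive⁻¹ 1ℚ)
    (≤-trans (≤-reflexive (cong (1ℚ when_) (sym z₀∈))) (∑-≥-term (allSubsets K) indicator≥0 (∈-allSubsets z₀)))
    where
    indicator≥0 : ∀ w → 0ℚ ≤ (1ℚ when member w)
    indicator≥0 w with member w
    ... | true  = nonNegative⁻¹ 1ℚ
    ... | false = ≤-refl

  instance
    size-positive : Positive size
    size-positive = positive size>0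

    size-nonZero : NonZero size
    size-nonZero = pos⇒nonZero size

  weight : ℚ
  weight = 1/ size

  weight>0 : 0ℚ < weight
  weight>0 = positive⁻¹ weight {{1/pos⇒pos size}}

  uniform : Subset K → ℚ
  uniform w = weight when member w

  uniform≥0 : ∀ w → 0ℚ ≤ uniform w
  uniform≥0 w with member w
  ... | true  = <⇒≤ weight>0
  ... | false = ≤-refl

  ∑-uniform : ∑ₛ uniform ≡ 1ℚ
  ∑-uniform = begin
    ∑ₛ uniform                               ≡⟨ ∑-cong (allSubsets K) scale ⟩
    ∑ₛ (λ w → weight * (1ℚ when member w))   ≡⟨ ∑-*ˡ (allSubsets K) weight (λ w → 1ℚ when member w) ⟩
    weight * size                            ≡⟨ *-inverseˡ size ⟩
    1ℚ                                       ∎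
    where
    open ≡-Reasoning
    scale : ∀ w → uniform w ≡ weight * (1ℚ when member w)
    scale w with member w
    ... | true  = sym (*-identityʳ weight)
    ... | false = sym (*-zeroʳ weight)

⊈⇒∃ : {n : ℕ} {p q : Subset n} → ¬ p ⊆ q → ∃ λ i → i ∈ p × i ∉ q
⊈⇒∃ {n} {p} {q} p⊈q
  with ¬∀⟶∃¬ n (λ i → i ∈ p → i ∈ q) (λ i → i ∈? p →-dec i ∈? q) (λ p⊆q → p⊈q (p⊆q _))
... | i , i∈p⇏i∈q with i ∈? p
...   | yes i∈p = i , i∈p , λ i∈q → i∈p⇏i∈q (λ _ → i∈q)
...   | no  i∉p = ⊥-elim (i∈p⇏i∈q (⊥-elim ∘ i∉p))

x∈p⇒⁅x⁆⊆p : {n : ℕ} {x : Fin n} {p : Subset n} → x ∈ p → ⁅ x ⁆ ⊆ p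
x∈p⇒⁅x⁆⊆p {x = x} x∈p i∈⁅x⁆ = subst (_∈ _) (sym (x∈⁅y⁆⇒x≡y x i∈⁅x⁆)) x∈p

pair : {n : ℕ} → Fin n → Fin n → Subset n
pair x y = ⁅ x ⁆ ∪ ⁅ y ⁆

module _ {n : ℕ} {x y : Fin n} where

  ⁅x⁆⊆pair : ⁅ x ⁆ ⊆ pair x y
  ⁅x⁆⊆pair = p⊆p∪q ⁅ y ⁆

  x∈pair : x ∈ pair x y
  x∈pair = ⁅x⁆⊆pair (x∈⁅x⁆ x)

  y∈pair : y ∈ pair x y
  y∈pair = q⊆p∪q ⁅ x ⁆ ⁅ y ⁆ (x∈⁅x⁆ y)

  pair⊆ : {p : Subset n} → x ∈ p → y ∈ p → pair x y ⊆ p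
  pair⊆ x∈p y∈p i∈ with x∈p∪q⁻ ⁅ x ⁆ ⁅ y ⁆ i∈
  ... | inj₁ i∈⁅x⁆ = x∈p⇒⁅x⁆⊆p x∈p i∈⁅x⁆
  ... | inj₂ i∈⁅y⁆ = x∈p⇒⁅x⁆⊆p y∈p i∈⁅y⁆

toggle : {n : ℕ} → Fin n → Subset n → Subset n
toggle d w = w [ d ]%= not

module _ {n : ℕ} {d : Fin n} where

  toggle-involutive : (w : Subset n) → toggle d (toggle d w) ≡ w
  toggle-involutive w = trans (updateAt-updateAt d w) (updateAt-id-local d w (Boolₚ.not-involutive _))

  ∈-toggle⁺ : {i : Fin n} {w : Subset n} → i ≢ d → i ∈ w → i ∈ toggle d w
  ∈-toggle⁺ {i} {w} i≢d = updateAt-minimal i d w i≢d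

  ∈-toggle⁻ : {i : Fin n} {w : Subset n} → i ≢ d → i ∈ toggle d w → i ∈ w
  ∈-toggle⁻ {i} {w} i≢d i∈ = subst (i ∈_) (toggle-involutive w) (∈-toggle⁺ i≢d i∈)

  ⊆-toggle : {U w : Subset n} → d ∉ U → U ⊆ toggle d w ⇔ U ⊆ w
  ⊆-toggle {U} {w} d∉U =
    mk⇔ (λ U⊆ {_} i∈U → ∈-toggle⁻ (≢d i∈U) (U⊆ i∈U)) (λ U⊆ {_} i∈U → ∈-toggle⁺ (≢d i∈U) (U⊆ i∈U))
    where
    ≢d : ∀ {i} → i ∈ U → i ≢ d
    ≢d i∈U refl = d∉U i∈U

  toggle-⊆ : {D w : Subset n} → d ∈ D → toggle d w ⊆ D ⇔ w ⊆ D
  toggle-⊆ {D} {w} d∈D = mk⇔ to from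
    where
    off-d⊆ : ∀ {v} → (∀ {i} → i ≢ d → i ∈ v → i ∈ D) → v ⊆ D
    off-d⊆ off-d {i} i∈v with i Fin.≟ d
    ... | yes refl = d∈D
    ... | no  i≢d  = off-d i≢d i∈v

    to : toggle d w ⊆ D → w ⊆ D
    to tw⊆D = off-d⊆ (λ i≢d i∈ → tw⊆D (∈-toggle⁺ i≢d i∈))

    from : w ⊆ D → toggle d w ⊆ D
    from w⊆D = off-d⊆ (λ i≢d i∈ → w⊆D (∈-toggle⁻ i≢d i∈))

parity : {n : ℕ} → Subset n → Bool
parity []      = false
parity (b ∷ p) = b xor parity p

parity-Empty : {n : ℕ} {p : Subset n} → Empty p → parity p ≡ false
parity-Empty {n} {p} p-empty = subst (λ q → parity q ≡ false) (sym (Empty-unique p-empty)) (parity-∅ n)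
  where
  parity-∅ : ∀ n → parity (∅ {n}) ≡ false
  parity-∅ zero    = refl
  parity-∅ (suc n) = parity-∅ n

parity-toggle-∩ : {n : ℕ} {d : Fin n} {D : Subset n} (w : Subset n) → d ∈ D →
                  parity (toggle d w ∩ D) ≡ not (parity (w ∩ D))
parity-toggle-∩ (true  ∷ w) here = sym (Boolₚ.not-involutive _)
parity-toggle-∩ (false ∷ w) here = refl
parity-toggle-∩ {D = b ∷ D} (a ∷ w) (there d∈D) =
  trans (cong ((a ∧ b) xor_) (parity-toggle-∩ w d∈D)) (sym (Boolₚ.not-distribʳ-xor (a ∧ b) _))

∣r∩p─q∣+∣r∩q∣≡∣r∩p∣ : {n : ℕ} (r p q : Subset n) → q ⊆ p →
                      ∣ r ∩ (p ─ q) ∣ ℕ.+ ∣ r ∩ q ∣ ≡ ∣ r ∩ p ∣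
∣r∩p─q∣+∣r∩q∣≡∣r∩p∣ []          []          []          _   = refl
∣r∩p─q∣+∣r∩q∣≡∣r∩p∣ (true  ∷ r) (true  ∷ p) (false ∷ q) q⊆p =
  cong suc (∣r∩p─q∣+∣r∩q∣≡∣r∩p∣ r p q (drop-∷-⊆ q⊆p))
∣r∩p─q∣+∣r∩q∣≡∣r∩p∣ (true  ∷ r) (true  ∷ p) (true  ∷ q) q⊆p =
  trans (ℕₚ.+-suc _ _) (cong suc (∣r∩p─q∣+∣r∩q∣≡∣r∩p∣ r p q (drop-∷-⊆ q⊆p)))
∣r∩p─q∣+∣r∩q∣≡∣r∩p∣ (true  ∷ r) (false ∷ p) (false ∷ q) q⊆p = ∣r∩p─q∣+∣r∩q∣≡∣r∩p∣ r p q (drop-∷-⊆ q⊆p)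
∣r∩p─q∣+∣r∩q∣≡∣r∩p∣ (false ∷ r) (_     ∷ p) (false ∷ q) q⊆p = ∣r∩p─q∣+∣r∩q∣≡∣r∩p∣ r p q (drop-∷-⊆ q⊆p)
∣r∩p─q∣+∣r∩q∣≡∣r∩p∣ (false ∷ r) (true  ∷ p) (true  ∷ q) q⊆p = ∣r∩p─q∣+∣r∩q∣≡∣r∩p∣ r p q (drop-∷-⊆ q⊆p)
∣r∩p─q∣+∣r∩q∣≡∣r∩p∣ (_     ∷ r) (false ∷ p) (true  ∷ q) q⊆p with () ← q⊆p here

module _ {A : Set} (_≟_ : DecidableEquality A) (a b : A) where

  transposition : A → A
  transposition z with z ≟ a | z ≟ b
  ... | yes _ | _     = b
  ... | no  _ | yes _ = a
  ... | no  _ | no  _ = z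

  transposition-fix : ∀ {z} → z ≢ a → z ≢ b → transposition z ≡ z
  transposition-fix {z} z≢a z≢b with z ≟ a | z ≟ b
  ... | yes z≡a | _       = ⊥-elim (z≢a z≡a)
  ... | no  _   | yes z≡b = ⊥-elim (z≢b z≡b)
  ... | no  _   | no  _   = refl

  transposition-a : transposition a ≡ b
  transposition-a with a ≟ a | a ≟ b
  ... | yes _   | _ = refl
  ... | no  a≢a | _ = ⊥-elim (a≢a refl)

  transposition-b : transposition b ≡ a
  transposition-b with b ≟ a | b ≟ b
  ... | yes b≡a | _       = b≡a
  ... | no  _   | yes _   = refl
  ... | no  _   | no  b≢b = ⊥-elim (b≢b refl)

  transposition-involutive : ∀ z → transposition (transposition z) ≡ z
  transposition-involutive z with z ≟ a | z ≟ b
  ... | yes refl | _        = transposition-b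
  ... | no  _    | yes refl = transposition-a
  ... | no  z≢a  | no  z≢b  = transposition-fix z≢a z≢b

least : {P : ℕ → Set} → (∀ n → Dec (P n)) → ∀ {n} → P n →
        ∃ λ m → P m × m ℕ.≤ n × (∀ k → k ℕ.< m → ¬ P k)
least P? {zero}  P₀ = 0 , P₀ , ℕ.z≤n , λ _ ()
least P? {suc n} Pₙ with P? 0
... | yes P₀ = 0 , P₀ , ℕ.z≤n , λ _ ()
... | no ¬P₀ with least (P? ∘ suc) Pₙ
...   | m , Pₘ , m≤n , below =
  suc m , Pₘ , ℕ.s≤s m≤n , λ { zero _ → ¬P₀ ; (suc k) (ℕ.s≤s k<m) → below k k<m }

lex⇒prefix-sums-equal :
  ∀ n {α β A B : ℕ → ℕ} → (∀ k → A (suc k) ≡ α k ℕ.+ A k) → (∀ k → B (suc k) ≡ β k ℕ.+ B k) →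
  A 0 ≡ B 0 → (∀ k → k ℕ.≤ n → A k ℕ.≤ B k) →
  Lex-≤ _≡_ ℕ._≤_ (tabulate {n = n} (β ∘ Fin.toℕ)) (tabulate {n = n} (α ∘ Fin.toℕ)) →
  ∀ k → k ℕ.≤ n → A k ≡ B k
lex⇒prefix-sums-equal zero A-step B-step A₀≡B₀ A≤B _ zero _ = A₀≡B₀
lex⇒prefix-sums-equal (suc n) {A = A} {B} A-step B-step A₀≡B₀ A≤B (this (β₀≤α₀ , β₀≢α₀) _) _ _ =
  ⊥-elim (ℕₚ.<-irrefl refl (ℕₚ.<-≤-trans B₁<A₁ (A≤B 1 (ℕ.s≤s ℕ.z≤n))))
  where
  B₁<A₁ : B 1 ℕ.< A 1
  B₁<A₁ = subst₂ ℕ._<_ (sym (B-step 0)) (sym (A-step 0))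
                 (ℕₚ.+-mono-<-≤ (ℕₚ.≤∧≢⇒< β₀≤α₀ β₀≢α₀) (ℕₚ.≤-reflexive (sym A₀≡B₀)))
lex⇒prefix-sums-equal (suc n) A-step B-step A₀≡B₀ A≤B (next _ _) zero _ = A₀≡B₀
lex⇒prefix-sums-equal (suc n) {A = A} {B} A-step B-step A₀≡B₀ A≤B (next β₀≡α₀ lex) (suc k) (ℕ.s≤s k≤n) =
  lex⇒prefix-sums-equal n (A-step ∘ suc) (B-step ∘ suc) A₁≡B₁ (λ k → A≤B (suc k) ∘ ℕ.s≤s) lex k k≤n
  where
  A₁≡B₁ : A 1 ≡ B 1
  A₁≡B₁ = trans (A-step 0) (trans (cong₂ ℕ._+_ (sym β₀≡α₀) A₀≡B₀) (sym (B-step 0)))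

module _ {A : Set} (f : A → Bool) where

  foldr-∨-intro : (L : List A) {a : A} → a List.∈ L → f a ≡ true → foldr (λ i b → f i ∨ b) false L ≡ true
  foldr-∨-intro (a ∷ L) (here refl) fa≡true rewrite fa≡true = refl
  foldr-∨-intro (b ∷ L) (there a∈L) fa≡true rewrite foldr-∨-intro L a∈L fa≡true = Boolₚ.∨-zeroʳ (f b)

  foldr-∨-elim : (L : List A) → foldr (λ i b → f i ∨ b) false L ≡ true → ∃ λ a → f a ≡ true
  foldr-∨-elim (a ∷ L) any≡true with f a in fa
  ... | true  = a , fa
  ... | false = foldr-∨-elim L any≡true

true≢false : true ≢ false
true≢false ()

∈⇒lookup : {n : ℕ} {i : Fin n} {p : Subset n} → i ∈ p → lookup p i ≡ true
∈⇒lookup = []=⇒lookup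

lookup⇒∈ : {n : ℕ} {i : Fin n} {p : Subset n} → lookup p i ≡ true → i ∈ p
lookup⇒∈ {i = i} {p} = lookup⇒[]= i p

module Walks {K : ℕ} {F : Family K} (F? : Decidable F) where

  open Algorithm K F F?

  Adj⇒adj : ∀ {x y} → Adj x y → adj x y ≡ true
  Adj⇒adj {x} {y} (x≢y , F⁅x,y⁆)
    rewrite dec-false (x Fin.≟ y) x≢y | dec-true (F? (pair x y)) F⁅x,y⁆ = refl

  adj⇒Adj : ∀ {x y} → adj x y ≡ true → Adj x y
  adj⇒Adj {x} {y} adj≡true with x Fin.≟ y | F? (pair x y)
  ... | no x≢y | yes F⁅x,y⁆ = x≢y , F⁅x,y⁆
  ... | no _   | no  _      = ⊥-elim (true≢false (sym adj≡true))
  ... | yes _  | _          = ⊥-elim (true≢false (sym adj≡true))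

  data Reach (C : Subset K) (x : Fin K) : ℕ → Fin K → Set where
    origin : Reach C x 0 x
    wait   : ∀ {j v} → Reach C x j v → Reach C x (suc j) v
    move   : ∀ {j u v} → Reach C x j u → u ∉ C → Adj u v → Reach C x (suc j) v

  private
    frontier : Subset K → Fin K → ℕ → Fin K → Fin K → Bool
    frontier C x j v u = lookup (N C x j) u ∧ not (lookup C u) ∧ adj u v

    lookup-N-suc : ∀ C x j v → lookup (N C x (suc j)) v ≡ (lookup (N C x j) v ∨ anyFin (frontier C x j v))
    lookup-N-suc C x j v = lookup∘tabulate (λ y → lookup (N C x j) y ∨ anyFin (frontier C x j y)) v

  Reach⇒∈N : ∀ {C x j v} → Reach C x j v → v ∈ N C x j
  Reach⇒∈N {x = x} origin = x∈⁅x⁆ x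
  Reach⇒∈N {C} {x} {suc j} {v} (wait ρ) = lookup⇒∈ (begin
    lookup (N C x (suc j)) v                        ≡⟨ lookup-N-suc C x j v ⟩
    lookup (N C x j) v ∨ anyFin (frontier C x j v)  ≡⟨ cong (_∨ anyFin (frontier C x j v)) v∈N ⟩
    true                                            ∎)
    where
    open ≡-Reasoning
    v∈N : lookup (N C x j) v ≡ true
    v∈N = ∈⇒lookup (Reach⇒∈N ρ)
  Reach⇒∈N {C} {x} {suc j} {v} (move {u = u} ρ u∉C u~v) = lookup⇒∈ (begin
    lookup (N C x (suc j)) v                        ≡⟨ lookup-N-suc C x j v ⟩
    lookup (N C x j) v ∨ anyFin (frontier C x j v)  ≡⟨ cong (lookup (N C x j) v ∨_) u-in-frontier ⟩
    lookup (N C x j) v ∨ true                       ≡⟨ Boolₚ.∨-zeroʳ _ ⟩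
    true                                            ∎)
    where
    open ≡-Reasoning
    u∈frontier : frontier C x j v u ≡ true
    u∈frontier rewrite ∈⇒lookup (Reach⇒∈N ρ) | Adj⇒adj u~v with lookup C u in u∈?C
    ... | true  = ⊥-elim (u∉C (lookup⇒∈ u∈?C))
    ... | false = refl
    u-in-frontier : anyFin (frontier C x j v) ≡ true
    u-in-frontier = foldr-∨-intro (frontier C x j v) (allFin K) (∈-allFin u) u∈frontier

  ∈N⇒Reach : ∀ {C x} j {v} → v ∈ N C x j → Reach C x j v
  ∈N⇒Reach {x = x} zero v∈⁅x⁆ rewrite x∈⁅y⁆⇒x≡y x v∈⁅x⁆ = origin
  ∈N⇒Reach {C} {x} (suc j) {v} v∈N
    with lookup (N C x j) v in v∈?N | trans (sym (lookup-N-suc C x j v)) (∈⇒lookup v∈N)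
  ... | true  | _ = wait (∈N⇒Reach j (lookup⇒∈ v∈?N))
  ... | false | any≡true with foldr-∨-elim (frontier C x j v) (allFin K) any≡true
  ...   | u , u∈frontier with lookup (N C x j) u in u∈?N | lookup C u in u∈?C
  ...     | true | false =
    move (∈N⇒Reach j (lookup⇒∈ u∈?N)) (λ u∈C → true≢false (trans (sym (∈⇒lookup u∈C)) u∈?C))
         (adj⇒Adj u∈frontier)

  Reach-≤ : ∀ {C x j j′ v} → j ℕ.≤ j′ → Reach C x j v → Reach C x j′ v
  Reach-≤ {j = zero}  {zero}   _            ρ              = ρ
  Reach-≤ {j = zero}  {suc j′} _            ρ              = wait (Reach-≤ ℕ.z≤n ρ)
  Reach-≤ {j = suc j} {suc j′} (ℕ.s≤s j≤j′) (wait ρ)       = wait (Reach-≤ j≤j′ ρ)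
  Reach-≤ {j = suc j} {suc j′} (ℕ.s≤s j≤j′) (move ρ u∉C a) = move (Reach-≤ j≤j′ ρ) u∉C a

  Reach-cons : ∀ {C t w b v} → t ∉ C → Adj t w → Reach C w b v → Reach C t (suc b) v
  Reach-cons t∉C t~w origin           = move origin t∉C t~w
  Reach-cons t∉C t~w (wait ρ)         = wait (Reach-cons t∉C t~w ρ)
  Reach-cons t∉C t~w (move ρ u∉C u~v) = move (Reach-cons t∉C t~w ρ) u∉C u~v

  Reach-from-∈ : ∀ {C w b v} → w ∈ C → Reach C w b v → v ≡ w
  Reach-from-∈ w∈C origin         = refl
  Reach-from-∈ w∈C (wait ρ)       = Reach-from-∈ w∈C ρ
  Reach-from-∈ w∈C (move ρ u∉C _) with refl ← Reach-from-∈ w∈C ρ = ⊥-elim (u∉C w∈C)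

  N-mono : ∀ {C x} k → N C x k ⊆ N C x (suc k)
  N-mono k v∈N = Reach⇒∈N (wait (∈N⇒Reach k v∈N))

  N-stable : ∀ {C x k} → N C x (suc k) ⊆ N C x k → ∀ m → N C x (m ℕ.+ k) ⊆ N C x k
  N-stable {C} {x} {k} N-stops m v∈N = Reach⇒∈N (stays m (∈N⇒Reach (m ℕ.+ k) v∈N))
    where
    stays : ∀ m {v} → Reach C x (m ℕ.+ k) v → Reach C x k v
    stays zero    ρ              = ρ
    stays (suc m) (wait ρ)       = stays m ρ
    stays (suc m) (move ρ u∉C a) = ∈N⇒Reach k (N-stops (Reach⇒∈N (move (stays m ρ) u∉C a)))

  first-reach<K : ∀ {C x j v} → v ∈ N C x j → (∀ k → k ℕ.< j → v ∉ N C x k) → j ℕ.< K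
  first-reach<K {C} {x} {j} {v} v∈N v-not-earlier = ℕₚ.≤-trans (grows j ℕₚ.≤-refl) (∣p∣≤n (N C x j))
    where
    grows : ∀ k → k ℕ.≤ j → suc k ℕ.≤ ∣ N C x k ∣
    grows zero    _   = ℕₚ.≤-reflexive (sym (∣⁅x⁆∣≡1 x))
    grows (suc k) k<j =
      ℕₚ.<-≤-trans (ℕ.s≤s (grows k (ℕₚ.<⇒≤ k<j))) (p⊂q⇒∣p∣<∣q∣ (N-mono k , ⊈⇒∃ N-grows))
      where
      N-grows : ¬ N C x (suc k) ⊆ N C x k
      N-grows N-stops = v-not-earlier k k<j
        (N-stable N-stops (j ℕ.∸ k) (subst (λ i → v ∈ N C x i) (sym (ℕₚ.m∸n+n≡m (ℕₚ.<⇒≤ k<j))) v∈N))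

  record Entry (C Y : Subset K) (x : Fin K) (j : ℕ) (v : Fin K) : Set where
    constructor entry
    field
      gate      : Fin K
      gate∈Y    : gate ∈ Y
      to-gate   : Reach Y x j gate
      rest      : ℕ
      rest<j    : rest ℕ.< j
      from-gate : Reach C gate rest v

  Reach-split : ∀ {C Y x j v} → x ∉ Y → Reach C x j v → (v ∉ Y × Reach Y x j v) ⊎ Entry C Y x j v
  Reach-split x∉Y origin = inj₁ (x∉Y , origin)
  Reach-split x∉Y (wait ρ) with Reach-split x∉Y ρ
  ... | inj₁ (v∉Y , σ)              = inj₁ (v∉Y , wait σ)
  ... | inj₂ (entry t t∈Y σ b b<j τ) = inj₂ (entry t t∈Y (wait σ) b (ℕₚ.m<n⇒m<1+n b<j) τ)
  Reach-split {Y = Y} x∉Y (move {v = v} ρ u∉C u~v) with Reach-split x∉Y ρ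
  ... | inj₂ (entry t t∈Y σ b b<j τ) = inj₂ (entry t t∈Y (wait σ) (suc b) (ℕ.s≤s b<j) (move τ u∉C u~v))
  ... | inj₁ (u∉Y , σ) with v ∈? Y
  ...   | no  v∉Y = inj₁ (v∉Y , move σ u∉Y u~v)
  ...   | yes v∈Y = inj₂ (entry v v∈Y (move σ u∉Y u~v) 0 (ℕ.s≤s ℕ.z≤n) origin)

  Reach-enter : ∀ {C Y x j v} → x ∉ Y → v ∈ Y → Reach C x j v → Entry C Y x j v
  Reach-enter x∉Y v∈Y ρ with Reach-split x∉Y ρ
  ... | inj₁ (v∉Y , _) = ⊥-elim (v∉Y v∈Y)
  ... | inj₂ e         = e

  ∈F⇒Adj : Antimonotonic F → ∀ {T t₁ t₂} → F T → t₁ ∈ T → t₂ ∈ T → t₁ ≢ t₂ → Adj t₁ t₂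
  ∈F⇒Adj anti T∈F t₁∈T t₂∈T t₁≢t₂ = t₁≢t₂ , anti _ _ (pair⊆ t₁∈T t₂∈T) T∈F

  ∣C∩N-suc∣ : ∀ C x k → ∣ C ∩ N C x (suc k) ∣ ≡ ∣ C ∩ (N C x (suc k) ─ N C x k) ∣ ℕ.+ ∣ C ∩ N C x k ∣
  ∣C∩N-suc∣ C x k = sym (∣r∩p─q∣+∣r∩q∣≡∣r∩p∣ C (N C x (suc k)) (N C x k) (N-mono k))

  ∣C∩N-zero∣ : ∀ {C x} → x ∉ C → ∣ C ∩ N C x 0 ∣ ≡ 0
  ∣C∩N-zero∣ {C} {x} x∉C = trans (cong ∣_∣ (Empty-unique C∩⁅x⁆-empty)) (∣⊥∣≡0 K)
    where
    C∩⁅x⁆-empty : Empty (C ∩ ⁅ x ⁆)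
    C∩⁅x⁆-empty (i , i∈) with x∈p∩q⁻ C ⁅ x ⁆ i∈
    ... | i∈C , i∈⁅x⁆ = x∉C (subst (_∈ C) (x∈⁅y⁆⇒x≡y x i∈⁅x⁆) i∈C)

module MaximalRank {K : ℕ} {F : Family K} (F? : Decidable F) (anti : Antimonotonic F)
  {C Y : Subset K} {r L : ℕ} {x : Fin K}
  (C⊆Y : C ⊆ Y) (x∉Y : x ∉ Y) (r≤L : r ℕ.≤ L) (K≤L : K ℕ.≤ L)
  (x∈Z : Algorithm.InZ K F F? C r x) where

  open Algorithm K F F?
  open Walks F?

  T : Subset K
  T = N Y x L ∩ Y

  Reach⇒∈T : ∀ {j t} → Reach Y x j t → j ℕ.≤ L → t ∈ Y → t ∈ T
  Reach⇒∈T ρ j≤L t∈Y = x∈p∩q⁺ (Reach⇒∈N (Reach-≤ j≤L ρ) , t∈Y)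

  x∈V : InV C x
  x∈V = proj₁ (proj₁ x∈Z)

  Ux∉F : ¬ F (Ux C x r)
  Ux∉F = proj₂ (proj₁ x∈Z)

  module _ (T∈F : F T) {t : Fin K} (t∈T : t ∈ T) (t∉C : t ∉ C) where

    transfer : ∀ {j v} → j ℕ.≤ L → Reach C x j v → v ∈ C → Reach C t j v
    transfer j≤L ρ v∈C with Reach-enter x∉Y (C⊆Y v∈C) ρ
    ... | entry t′ t′∈Y σ b b<j τ with t′ Fin.≟ t
    ...   | yes refl = Reach-≤ (ℕₚ.<⇒≤ b<j) τ
    ...   | no  t′≢t = Reach-≤ b<j (Reach-cons t∉C t~t′ τ)
      where
      t~t′ : Adj t t′
      t~t′ = ∈F⇒Adj anti T∈F t∈T (Reach⇒∈T σ j≤L t′∈Y) (t′≢t ∘ sym)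

    C∩N-⊆ : ∀ {k} → k ℕ.≤ L → C ∩ N C x k ⊆ C ∩ N C t k
    C∩N-⊆ {k} k≤L v∈ with x∈p∩q⁻ C (N C x k) v∈
    ... | v∈C , v∈N = x∈p∩q⁺ (v∈C , Reach⇒∈N (transfer k≤L (∈N⇒Reach k v∈N) v∈C))

    Ux-⊆ : Ux C x r ⊆ Ux C t r
    Ux-⊆ v∈ with x∈p∩q⁻ (N C x r) C v∈
    ... | v∈N , v∈C = x∈p∩q⁺ (Reach⇒∈N (transfer r≤L (∈N⇒Reach r v∈N) v∈C) , v∈C)

    ∈W : InW C r t
    ∈W with proj₂ x∈V
    ... | c₀ , c₀∈C , x~c₀ = (t∉C , c₀ , c₀∈C , ∈F⇒Adj anti T∈F t∈T c₀∈T t≢c₀) , Ux∉F ∘ anti _ _ Ux-⊆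
      where
      c₀∈T : c₀ ∈ T
      c₀∈T = Reach⇒∈T (move origin x∉Y x~c₀) (ℕₚ.≤-trans (ℕ.>-nonZero⁻¹ K {{nonZeroIndex x}}) K≤L)
                      (C⊆Y c₀∈C)
      t≢c₀ : t ≢ c₀
      t≢c₀ refl = t∉C c₀∈C

  neighbourhood∉F : ¬ F T
  neighbourhood∉F T∈F with ⊈⇒∃ (λ Ux⊆T → Ux∉F (anti _ T Ux⊆T T∈F))
  ... | c , c∈Ux , c∉T with x∈p∩q⁻ (N C x r) C c∈Ux
  ... | c∈N , c∈C with least (λ j → c ∈? N C x j) c∈N
  ... | j₁ , c∈Nj₁ , j₁≤r , c-not-earlier with Reach-enter x∉Y (C⊆Y c∈C) (∈N⇒Reach j₁ c∈Nj₁)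
  ... | entry t t∈Y x⇝t b b<j₁ t⇝c = ℕₚ.<-irrefl same-count larger-count
    where
    t∈T : t ∈ T
    t∈T = Reach⇒∈T x⇝t (ℕₚ.≤-trans j₁≤r r≤L) t∈Y
    t∉C : t ∉ C
    t∉C t∈C with refl ← Reach-from-∈ t∈C t⇝c = c∉T t∈T
    b≤K∸1 : b ℕ.≤ K ℕ.∸ 1
    b≤K∸1 = ℕₚ.≤-trans (ℕₚ.<⇒≤ b<j₁) (ℕₚ.<⇒≤pred (first-reach<K c∈Nj₁ c-not-earlier))
    ≤L : ∀ {k} → k ℕ.≤ K ℕ.∸ 1 → k ℕ.≤ L
    ≤L k≤K∸1 = ℕₚ.≤-trans k≤K∸1 (ℕₚ.≤-trans (ℕₚ.m∸n≤m K 1) K≤L)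
    same-count : ∣ C ∩ N C x b ∣ ≡ ∣ C ∩ N C t b ∣
    same-count = lex⇒prefix-sums-equal (K ℕ.∸ 1) (∣C∩N-suc∣ C x) (∣C∩N-suc∣ C t)
      (trans (∣C∩N-zero∣ (proj₁ x∈V)) (sym (∣C∩N-zero∣ t∉C)))
      (λ k k≤K∸1 → p⊆q⇒∣p∣≤∣q∣ (C∩N-⊆ T∈F t∈T t∉C (≤L k≤K∸1)))
      (proj₂ x∈Z t (∈W T∈F t∈T t∉C)) b b≤K∸1
    larger-count : ∣ C ∩ N C x b ∣ ℕ.< ∣ C ∩ N C t b ∣
    larger-count = p⊂q⇒∣p∣<∣q∣ (C∩N-⊆ T∈F t∈T t∉C (≤L b≤K∸1) ,
      c , x∈p∩q⁺ (c∈C , Reach⇒∈N t⇝c) , c-not-earlier b b<j₁ ∘ proj₂ ∘ x∈p∩q⁻ C (N C x b))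

module ParityCounterexample {K : ℕ} {F : Family K} (F? : Decidable F) (anti : Antimonotonic F)
  {Y : Subset K} {x c₀ : Fin K} {L : ℕ}
  (x∉Y : x ∉ Y) (c₀∈Y : c₀ ∈ Y) (x~c₀ : Algorithm.Adj K F F? x c₀) (1≤L : 1 ℕ.≤ L)
  (T∉F : ¬ F (Algorithm.N K F F? Y x L ∩ Y)) where

  open Algorithm K F F?
  open Walks F?

  S T : Subset K
  S = N Y x L ∩ ∁ Y
  T = N Y x L ∩ Y

  ∈S⇒∉Y : ∀ {u} → u ∈ S → u ∉ Y
  ∈S⇒∉Y u∈S = x∈∁p⇒x∉p (proj₂ (x∈p∩q⁻ (N Y x L) (∁ Y) u∈S))

  ∈T⇒∈Y : ∀ {v} → v ∈ T → v ∈ Y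
  ∈T⇒∈Y v∈T = proj₂ (x∈p∩q⁻ (N Y x L) Y v∈T)

  Reach⇒∈S : ∀ {j u} → Reach Y x j u → j ℕ.≤ L → u ∉ Y → u ∈ S
  Reach⇒∈S ρ j≤L u∉Y = x∈p∩q⁺ (Reach⇒∈N (Reach-≤ j≤L ρ) , x∉p⇒x∈∁p u∉Y)

  Reach⇒∈T : ∀ {j v} → Reach Y x j v → j ℕ.≤ L → v ∈ Y → v ∈ T
  Reach⇒∈T ρ j≤L v∈Y = x∈p∩q⁺ (Reach⇒∈N (Reach-≤ j≤L ρ) , v∈Y)

  x∈S : x ∈ S
  x∈S = Reach⇒∈S origin ℕ.z≤n x∉Y

  c₀∈T : c₀ ∈ T
  c₀∈T = Reach⇒∈T (move origin x∉Y x~c₀) 1≤L c₀∈Y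

  ⁅x⁆∈F : F ⁅ x ⁆
  ⁅x⁆∈F = anti _ _ ⁅x⁆⊆pair (proj₂ x~c₀)

  even odd : Subset K → Bool
  even w = does (w ⊆? T) ∧ not (parity (w ∩ T))
  odd  w = does (w ⊆? T) ∧ parity (w ∩ T)

  even-∅ : even ∅ ≡ true
  even-∅ rewrite dec-true (∅ ⊆? T) (⊥-elim ∘ ∉⊥) | parity-Empty {p = ∅ ∩ T} (∉⊥ ∘ p∩q⊆p ∅ T ∘ proj₂) =
    refl

  even∘toggle : ∀ {d} w → d ∈ T → even (toggle d w) ≡ odd w
  even∘toggle {d} w d∈T rewrite does-⇔ (toggle-⊆ d∈T) (toggle d w ⊆? T) (w ⊆? T) | parity-toggle-∩ w d∈T =
    cong (does (w ⊆? T) ∧_) (Boolₚ.not-involutive (parity (w ∩ T)))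

  open Uniform even ∅ even-∅ using (weight; weight>0)
    renaming (uniform to pEven; uniform≥0 to pEven≥0; ∑-uniform to ∑-pEven)

  pOdd : Subset K → ℚ
  pOdd w = weight when odd w

  pEven∘toggle : ∀ {d} w → d ∈ T → pEven (toggle d w) ≡ pOdd w
  pEven∘toggle w d∈T = cong (weight when_) (even∘toggle w d∈T)

  pOdd-even : ∀ w → parity (w ∩ T) ≡ false → pOdd w ≡ 0ℚ
  pOdd-even w w-even rewrite w-even = cong (weight when_) (Boolₚ.∧-zeroʳ (does (w ⊆? T)))

  pOdd-off-Y : ∀ w → ¬ w ⊆ Y → pOdd w ≡ 0ℚ
  pOdd-off-Y w w⊈Y rewrite dec-false (w ⊆? T) (λ w⊆T → w⊈Y (∈T⇒∈Y ∘ w⊆T)) = refl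

  pOdd-isDistOn : IsDistOn Y pOdd
  pOdd-isDistOn = (λ w _ → subst (0ℚ ≤_) (pEven∘toggle w c₀∈T) (pEven≥0 (toggle c₀ w))) , (begin
    sumOver (_⊆? Y) pOdd     ≡⟨ sumOver-support (_⊆? Y) pOdd-off-Y ⟩
    ∑ₛ pOdd                  ≡⟨ ∑-cong (allSubsets K) (λ w → pEven∘toggle w c₀∈T) ⟨
    ∑ₛ (pEven ∘ toggle c₀)   ≡⟨ ∑ₛ-∘-involution (toggle c₀) toggle-involutive pEven ⟩
    ∑ₛ pEven                 ≡⟨ ∑-pEven ⟩
    1ℚ                       ∎)
    where open ≡-Reasoning

  σ : Subset K → Subset K
  σ = transposition _≟ₛ_ ∅ S

  σσ≗id : ∀ z → σ (σ z) ≡ z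
  σσ≗id = transposition-involutive _≟ₛ_ ∅ S

  -- Uniform on the even subsets of T, except that the weight of ∅ sits on S (note pEven S ≡ 0).
  p₀ : Subset K → ℚ
  p₀ = pEven ∘ σ

  θ : Subset K → ℚ
  θ = E[S] p₀

  θ-isFrequency : IsFrequency F θ
  θ-isFrequency = p₀ , (pEven≥0 ∘ σ , ∑-p₀) , λ _ _ → refl
    where
    ∑-p₀ : sumOver (λ _ → yes tt) p₀ ≡ 1ℚ
    ∑-p₀ = trans (sumOver-∑ₛ {K = K} (λ _ → yes tt) {f = p₀})
                 (trans (∑ₛ-∘-involution σ σσ≗id pEven) ∑-pEven)

  ⊆S⇔⊆∅ : ∀ {U} → U ⊆ Y → U ⊆ S ⇔ U ⊆ ∅
  ⊆S⇔⊆∅ {U} U⊆Y = mk⇔ to (λ U⊆∅ i∈U → ⊥-elim (∉⊥ (U⊆∅ i∈U)))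
    where
    to : U ⊆ S → U ⊆ ∅
    to U⊆S i∈U = ⊥-elim (∈S⇒∉Y (U⊆S i∈U) (U⊆Y i∈U))

  σ-preserves-⊆ : ∀ {U} → U ⊆ Y → ∀ z → U ⊆ σ z ⇔ U ⊆ z
  σ-preserves-⊆ {U} U⊆Y z = by-cases (z ≟ₛ ∅) (z ≟ₛ S)
    where
    by-cases : Dec (z ≡ ∅) → Dec (z ≡ S) → U ⊆ σ z ⇔ U ⊆ z
    by-cases (yes refl) _          =
      subst (λ w → U ⊆ w ⇔ U ⊆ ∅) (sym (transposition-a _≟ₛ_ ∅ S)) (⊆S⇔⊆∅ U⊆Y)
    by-cases (no _)     (yes refl) =
      subst (λ w → U ⊆ w ⇔ U ⊆ S) (sym (transposition-b _≟ₛ_ ∅ S)) (⇔-sym (⊆S⇔⊆∅ U⊆Y))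
    by-cases (no z≢∅)   (no z≢S)   =
      subst (λ w → U ⊆ w ⇔ U ⊆ z) (sym (transposition-fix _≟ₛ_ ∅ S z≢∅ z≢S)) (⇔-id _)

  marginals-agree : ∀ U → F U → U ⊆ Y → E[S]On Y pOdd U ≡ θ U
  marginals-agree U U∈F U⊆Y with ⊈⇒∃ (λ T⊆U → T∉F (anti T U T⊆U U∈F))
  ... | d , d∈T , d∉U = begin
    E[S]On Y pOdd U            ≡⟨ sumOver-×-support (_⊆? Y) pOdd-off-Y (U ⊆?_) ⟩
    E[S] pOdd U                ≡⟨ E[S]-cong (λ w → pEven∘toggle w d∈T) ⟨
    E[S] (pEven ∘ toggle d) U  ≡⟨ E[S]-∘-involution {p = pEven} (toggle d) toggle-involutive ⊆-toggle-d ⟩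
    E[S] pEven U               ≡⟨ E[S]-∘-involution {p = pEven} σ σσ≗id (σ-preserves-⊆ U⊆Y) ⟨
    θ U                        ∎
    where
    open ≡-Reasoning
    ⊆-toggle-d : ∀ w → U ⊆ toggle d w ⇔ U ⊆ w
    ⊆-toggle-d _ = ⊆-toggle d∉U

  p₀-null : ∀ {u z} → u ∈ S → u ∈ z → z ≢ S → p₀ z ≡ 0ℚ
  p₀-null {u} {z} u∈S u∈z z≢S = begin
    pEven (σ z)  ≡⟨ cong pEven (transposition-fix _≟ₛ_ ∅ S z≢∅ z≢S) ⟩
    pEven z      ≡⟨ cong (λ b → weight when b ∧ not (parity (z ∩ T))) z⊈T ⟩
    0ℚ           ∎
    where
    open ≡-Reasoning
    z≢∅ : z ≢ ∅
    z≢∅ refl = ∉⊥ u∈z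
    z⊈T : does (z ⊆? T) ≡ false
    z⊈T = dec-false (z ⊆? T) (λ z⊆T → ∈S⇒∉Y u∈S (∈T⇒∈Y (z⊆T u∈z)))

  θ-S-edge : ∀ {u v} → u ∈ S → v ∈ S → θ ⁅ u ⁆ ≡ θ (pair u v)
  θ-S-edge u∈S v∈S = E[S]-≡ ⁅x⁆⊆pair λ z ⁅u⁆⊆z pair⊈z →
    p₀-null u∈S (⁅u⁆⊆z (x∈⁅x⁆ _)) (λ { refl → pair⊈z (pair⊆ u∈S v∈S) })

  θ-T-edge : ∀ {u v} → u ∈ S → v ∈ T → θ (pair u v) ≡ 0ℚ
  θ-T-edge {u} {v} u∈S v∈T = sumOver-null (pair u v ⊆?_) λ z pair⊆z →
    p₀-null u∈S (pair⊆z x∈pair) (λ { refl → ∈S⇒∉Y (pair⊆z y∈pair) (∈T⇒∈Y v∈T) })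

  θ-x>0 : 0ℚ < θ ⁅ x ⁆
  θ-x>0 = <-≤-trans weight>0
    (≤-trans (≤-reflexive (sym p₀-S)) (sumOver-≥-term (⁅ x ⁆ ⊆?_) p₀≥0 (x∈p⇒⁅x⁆⊆p x∈S)))
    where
    p₀≥0 : ∀ z → 0ℚ ≤ p₀ z
    p₀≥0 = pEven≥0 ∘ σ
    p₀-S : p₀ S ≡ weight
    p₀-S = trans (cong pEven (transposition-b _≟ₛ_ ∅ S)) (cong (weight when_) even-∅)

  module _ {p : Subset K → ℚ} (p≥0 : ∀ z → 0ℚ ≤ p z) (p-sat : Satisfies F θ p)
           {z : Subset K} (0<pz : 0ℚ < p z) (x∈z : x ∈ z) where

    S-closed : ∀ {j u} → Reach Y x j u → j ℕ.≤ L → u ∉ Y → u ∈ z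
    S-closed origin   _   _   = x∈z
    S-closed (wait ρ) j≤L u∉Y = S-closed ρ (ℕₚ.<⇒≤ j≤L) u∉Y
    S-closed (move ρ u∉Y u~v@(_ , pair∈F)) j≤L v∉Y =
      E[S]-≡⇒⊆ p≥0 ⁅x⁆⊆pair Eu≡Euv (x∈p⇒⁅x⁆⊆p (S-closed ρ (ℕₚ.<⇒≤ j≤L) u∉Y)) 0<pz y∈pair
      where
      Eu≡Euv : E[S] p ⁅ _ ⁆ ≡ E[S] p (pair _ _)
      Eu≡Euv = begin
        E[S] p ⁅ _ ⁆      ≡⟨ p-sat _ (anti _ _ ⁅x⁆⊆pair pair∈F) ⟩
        θ ⁅ _ ⁆           ≡⟨ θ-S-edge (Reach⇒∈S ρ (ℕₚ.<⇒≤ j≤L) u∉Y) (Reach⇒∈S (move ρ u∉Y u~v) j≤L v∉Y) ⟩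
        θ (pair _ _)      ≡⟨ p-sat _ pair∈F ⟨
        E[S] p (pair _ _) ∎
        where open ≡-Reasoning

    T-avoided : ∀ {j v} → Reach Y x j v → j ℕ.≤ L → v ∈ Y → v ∉ z
    T-avoided origin   _   x∈Y = ⊥-elim (x∉Y x∈Y)
    T-avoided (wait ρ) j≤L v∈Y = T-avoided ρ (ℕₚ.<⇒≤ j≤L) v∈Y
    T-avoided (move ρ u∉Y u~v@(_ , pair∈F)) j≤L v∈Y v∈z =
      E[S]≡0⇒¬>0 p≥0 Euv≡0 (pair⊆ (S-closed ρ (ℕₚ.<⇒≤ j≤L) u∉Y) v∈z) 0<pz
      where
      Euv≡0 : E[S] p (pair _ _) ≡ 0ℚ
      Euv≡0 = trans (p-sat _ pair∈F)
                    (θ-T-edge (Reach⇒∈S ρ (ℕₚ.<⇒≤ j≤L) u∉Y) (Reach⇒∈T (move ρ u∉Y u~v) j≤L v∈Y))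

    z∩Y-even : parity ((z ∩ Y) ∩ T) ≡ false
    z∩Y-even = parity-Empty λ (i , i∈) →
      let i∈z∩Y , i∈T = x∈p∩q⁻ (z ∩ Y) T i∈
      in T-avoided (∈N⇒Reach L (p∩q⊆p (N Y x L) Y i∈T)) ℕₚ.≤-refl (∈T⇒∈Y i∈T) (p∩q⊆p z Y i∈z∩Y)

  ¬Safe : ¬ Safe F Y
  ¬Safe Y-safe with Y-safe θ θ-isFrequency pOdd pOdd-isDistOn marginals-agree
  ... | p , (p≥0 , _) , p-extends , p-sat
    with sumOver>0⇒∃>0 (⁅ x ⁆ ⊆?_) (subst (0ℚ <_) (sym (p-sat ⁅ x ⁆ ⁅x⁆∈F)) θ-x>0)
  ... | z , ⁅x⁆⊆z , 0<pz = <-irrefl refl (<-≤-trans 0<pz (begin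
    p z                                  ≤⟨ sumOver-≥-term (λ z′ → z′ ∩ Y ≟ₛ z ∩ Y) p≥0 refl ⟩
    sumOver (λ z′ → z′ ∩ Y ≟ₛ z ∩ Y) p   ≡⟨ p-extends (z ∩ Y) (p∩q⊆q z Y) ⟩
    pOdd (z ∩ Y)                         ≡⟨ pOdd-even (z ∩ Y) (z∩Y-even p≥0 p-sat 0<pz (⁅x⁆⊆z (x∈⁅x⁆ x))) ⟩
    0ℚ                                   ∎))
    where open ≤-Reasoning

theorem6 : (K : ℕ) (F : Family K) (F? : Decidable F) → Antimonotonic F →
           (B C : Subset K) → Algorithm.Run K F F? B C →
           (r : ℕ) → Algorithm.ViolationAt K F F? C r →
           (Y : Subset K) → Safe F Y → C ⊆ Y →
           ∀ (x : Fin K) → Algorithm.InZ K F F? C r x → x ∈ Y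
theorem6 K F F? anti _ C _ r _ Y Y-safe C⊆Y x x∈Z with x ∈? Y
... | yes x∈Y = x∈Y
... | no  x∉Y with proj₂ (proj₁ (proj₁ x∈Z))
...   | c₀ , c₀∈C , x~c₀ =
  ⊥-elim (ParityCounterexample.¬Safe F? anti x∉Y (C⊆Y c₀∈C) x~c₀ 1≤L T∉F Y-safe)
  where
  L : ℕ
  L = r ℕ.+ K
  1≤L : 1 ℕ.≤ L
  1≤L = ℕₚ.≤-trans (ℕ.>-nonZero⁻¹ K {{nonZeroIndex x}}) (ℕₚ.m≤n+m K r)
  T∉F : ¬ F (Algorithm.N K F F? Y x L ∩ Y)
  T∉F = MaximalRank.neighbourhood∉F F? anti C⊆Y x∉Y (ℕₚ.m≤m+n r K) (ℕₚ.m≤n+m K r) x∈Z
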